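{- For a word $w$ over $\{\mathtt{a},\mathtt{b}\}$ let $\mathrm{ext}(w)=\{\mathtt{a}w\mathtt{a},\mathtt{a}w\mathtt{b},\mathtt{b}w\mathtt{a},\mathtt{b}w\mathtt{b}\}$. Then for each $i\ge5$, the set of minimal unique substrings of $T_i$ is $\mathrm{ext}(T_{i-3})\cup\mathrm{ext}(\overline{T_{i-3}})$.
   Context: The Thue–Morse morphism is $\mu(\mathtt{a})=\mathtt{ab}$, $\mu(\mathtt{b})=\mathtt{ba}$, and $T_i=\mu^{i-1}(\mathtt{a})$ for $i\ge1$. For a binary word $w$, $\overline{w}$ is obtained by swapping $\mathtt{a}$ and $\mathtt{b}$. A minimal unique substring (MUS) of $w$ is a substring $u$ occurring exactly once in $w$, say at $[i,j]$, such that both $w[i+1..j]$ and $w[i..j-1]$ occur at least twice in $w$. -}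

module Defs where

open import Data.Nat using (ℕ; zero; suc; _+_; _≤_)
open import Data.List using (List; []; _∷_; _++_; [_]; length; take; drop; concatMap)
open import Data.Product using (Σ; _×_; ∃; ∃-syntax; _,_)
open import Relation.Binary.PropositionalEquality using (_≡_; _≢_)

data Letter : Set where
  a b : Letter

Word : Set
Word = List Letter

μ₁ : Letter → Word
μ₁ a = a ∷ b ∷ []
μ₁ b = b ∷ a ∷ []

μ : Word → Word
μ = concatMap μ₁

μ^ : ℕ → Word → Word
μ^ zero w = w
μ^ (suc n) w = μ (μ^ n w)

-- T i = μ^(i-1)(a) for i ≥ 1  (T 0 is unused; we set it to a)
T : ℕ → Word
T zero = a ∷ []
T (suc n) = μ^ n (a ∷ [])

flipL : Letter → Letter
flipL a = b
flipL b = a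

comp : Word → Word
comp [] = []
comp (x ∷ w) = flipL x ∷ comp w

OccursAt : Word → Word → ℕ → Set
OccursAt u w i = (i + length u ≤ length w) × (take (length u) (drop i w) ≡ u)

UniqueAt : Word → Word → ℕ → Set
UniqueAt u w i = OccursAt u w i × (∀ j → OccursAt u w j → j ≡ i)

OccursTwice : Word → Word → Set
OccursTwice u w = Σ ℕ λ i → Σ ℕ λ j → i ≢ j × OccursAt u w i × OccursAt u w j

-- minimal unique substring: a (nonempty) substring u = w[i..j] occurring exactly once
-- such that w[i+1..j] and w[i..j-1] both occur at least twice.
-- Writing u = x ∷ v = v' ++ [y]: w[i+1..j] = v and w[i..j-1] = v'.
IsMUS : Word → Word → Set
IsMUS u w =
  (Σ ℕ λ i → UniqueAt u w i)
  × (∀ x v → u ≡ x ∷ v → OccursTwice v w)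
  × (∀ v y → u ≡ v ++ [ y ] → OccursTwice v w)

InExt : Word → Word → Set
InExt w u = Σ Letter λ x → Σ Letter λ y → u ≡ x ∷ (w ++ [ y ])

module Submission where

-- Induction on n for T (5 + n), the base case T 5 being a finite computation.  Write w = T (5 + n),
-- so that T (6 + n) = μ w.  Every factor of length ≤ 3 of w occurs twice in w, hence every factor of
-- length ≤ 5 of μ w occurs twice in μ w, and MUSs of μ w have length ≥ 6.  As w has no factor xxx,
-- an occurrence in μ w of a word starting with the image of two letters is synchronised: it starts at
-- an even position.  So long factors of μ w desubstitute uniquely, and the MUSs of μ w are exactly the
-- words c̄ μ(v) d with c v d a MUS of w; in particular ext(B) is carried to ext(μ B).

open import Defs
open import Data.Empty using (⊥-elim)
open import Data.List using (List; []; _∷_; _++_; [_]; length; take; drop; filter; upTo; initLast; _∷ʳ′_)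
open import Data.List.Membership.Propositional using (_∈_)
open import Data.List.Membership.Propositional.Properties using (∈-filter⁺; ∈-filter⁻; ∈-upTo⁺)
open import Data.List.Properties
  using (++-assoc; length-++; length-take; take++drop≡id; ∷-injective; ∷ʳ-injective; ∷ʳ-injectiveˡ; ≡-dec)
open import Data.List.Relation.Unary.All using (_∷_)
open import Data.List.Relation.Unary.AllPairs using (_∷_)
open import Data.List.Relation.Unary.Any using (here; there)
open import Data.List.Relation.Unary.Any.Properties using (¬Any[]; singleton⁻)
open import Data.List.Relation.Unary.Unique.Propositional using (Unique)
import Data.List.Relation.Unary.Unique.Propositional.Properties as Unique
open import Data.Nat using (ℕ; zero; suc; _+_; _*_; _^_; _∸_; _≤_; _<_; _≤?_; z≤n; s≤s)
open import Data.Nat.Properties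
  using ( +-comm; *-suc; *-cancelˡ-≡; *-cancelˡ-≤; *-cancelˡ-<; *-monoʳ-≤; m^n>0; even≢odd; suc-injective
        ; ≤-trans; ≤-pred; ≤∧≢⇒<; ≰⇒>; m≤m+n; m≤n+m; m≤n⇒m≤1+n; +-monoʳ-≤; m≤n⇒m⊓n≡m; allUpTo?)
open import Data.Product using (Σ; ∃; ∃₂; _×_; _,_; proj₁; proj₂)
open import Data.Sum using (_⊎_; inj₁; inj₂) renaming (map to ⊎-map)
open import Function using (_∘_)
open import Function.Bundles using (_⇔_; mk⇔; Equivalence)
open import Function.Construct.Composition using (_⇔-∘_)
open import Function.Construct.Symmetry using (⇔-sym)
open import Relation.Binary.Definitions using (DecidableEquality)
open import Relation.Binary.PropositionalEquality
  using (_≡_; _≢_; refl; sym; trans; cong; cong₂; subst; subst₂; module ≡-Reasoning)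
open import Relation.Nullary using (¬_; contradiction)
open import Relation.Nullary.Decidable using (Dec; yes; no; map′; _×-dec_; _⊎-dec_; _→-dec_; from-yes)

open Equivalence

-- μ′ is μ with the image of a letter x written as x ∷ flipL x, so that it computes on words whose
-- letters are variables.
μ′ : Word → Word
μ′ [] = []
μ′ (x ∷ w) = x ∷ flipL x ∷ μ′ w

μ≡μ′ : ∀ w → μ w ≡ μ′ w
μ≡μ′ [] = refl
μ≡μ′ (a ∷ w) = cong (λ v → a ∷ b ∷ v) (μ≡μ′ w)
μ≡μ′ (b ∷ w) = cong (λ v → b ∷ a ∷ v) (μ≡μ′ w)

T-suc : ∀ n → T (suc (suc n)) ≡ μ′ (T (suc n))
T-suc n = μ≡μ′ (T (suc n))

flipL-involutive : ∀ x → flipL (flipL x) ≡ x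
flipL-involutive a = refl
flipL-involutive b = refl

flipL-injective : ∀ {x y} → flipL x ≡ flipL y → x ≡ y
flipL-injective {x} {y} e = trans (sym (flipL-involutive x)) (trans (cong flipL e) (flipL-involutive y))

length-∷ʳ : ∀ (u : Word) x → length (u ++ [ x ]) ≡ suc (length u)
length-∷ʳ u x = trans (length-++ u) (+-comm (length u) 1)

length-comp : ∀ w → length (comp w) ≡ length w
length-comp [] = refl
length-comp (x ∷ w) = cong suc (length-comp w)

μ′-++ : ∀ u v → μ′ (u ++ v) ≡ μ′ u ++ μ′ v
μ′-++ [] v = refl
μ′-++ (x ∷ u) v = cong (λ w → x ∷ flipL x ∷ w) (μ′-++ u v)

μ′-comp : ∀ w → μ′ (comp w) ≡ comp (μ′ w)
μ′-comp [] = refl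
μ′-comp (x ∷ w) = cong (λ v → flipL x ∷ flipL (flipL x) ∷ v) (μ′-comp w)

length-μ′ : ∀ w → length (μ′ w) ≡ 2 * length w
length-μ′ [] = refl
length-μ′ (x ∷ w) = trans (cong (λ n → suc (suc n)) (length-μ′ w)) (sym (*-suc 2 (length w)))

length-μ′-∷ʳ : ∀ w c → length (μ′ w ++ [ c ]) ≡ suc (2 * length w)
length-μ′-∷ʳ w c = trans (length-∷ʳ (μ′ w) c) (cong suc (length-μ′ w))

μ′-injective : ∀ u v → μ′ u ≡ μ′ v → u ≡ v
μ′-injective [] [] _ = refl
μ′-injective (x ∷ u) (y ∷ v) e with ∷-injective e
... | x≡y , e′ = cong₂ _∷_ x≡y (μ′-injective u v (proj₂ (∷-injective e′)))

μ′-∷ʳ-≢ : ∀ u t v → μ′ u ++ [ t ] ≢ μ′ v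
μ′-∷ʳ-≢ [] t (_ ∷ _ ∷ _) ()
μ′-∷ʳ-≢ (x ∷ u) t (y ∷ v) e = μ′-∷ʳ-≢ u t v (proj₂ (∷-injective (proj₂ (∷-injective e))))

length-T : ∀ n → length (T (suc n)) ≡ 2 ^ n
length-T zero = refl
length-T (suc n) = trans (cong length (T-suc n)) (trans (length-μ′ (T (suc n))) (cong (2 *_) (length-T n)))

2*-injective : ∀ {m n} → 2 * m ≡ 2 * n → m ≡ n
2*-injective = *-cancelˡ-≡ _ _ 2

2*m≤1+2*n⇒m≤n : ∀ {m n} → 2 * m ≤ suc (2 * n) → m ≤ n
2*m≤1+2*n⇒m≤n {m} {n} le = *-cancelˡ-≤ 2 (≤-pred (≤∧≢⇒< le (even≢odd m n)))

TwiceBy : (Word → Word → ℕ → Set) → Word → Word → Set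
TwiceBy O v w = Σ ℕ λ i → Σ ℕ λ j → i ≢ j × O v w i × O v w j

UniqueBy : (Word → Word → ℕ → Set) → Word → Word → Set
UniqueBy O u w = Σ ℕ λ i → O u w i × (∀ j → O u w j → j ≡ i)

-- IsMUS u w unfolds to MUSBy OccursAt u w.
MUSBy : (Word → Word → ℕ → Set) → Word → Word → Set
MUSBy O u w = UniqueBy O u w
  × (∀ x v → u ≡ x ∷ v → TwiceBy O v w)
  × (∀ v y → u ≡ v ++ [ y ] → TwiceBy O v w)

TwiceBy-map : ∀ {O O′ : Word → Word → ℕ → Set} {v w} →
  (∀ {u w p} → O u w p → O′ u w p) → TwiceBy O v w → TwiceBy O′ v w
TwiceBy-map f (i , j , i≢j , oᵢ , oⱼ) = i , j , i≢j , f oᵢ , f oⱼ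

MUSBy-map : ∀ {O O′ : Word → Word → ℕ → Set} {u w} →
  (∀ {u w p} → O u w p ⇔ O′ u w p) → MUSBy O u w → MUSBy O′ u w
MUSBy-map {O} {O′} O⇔O′ ((i , oᵢ , only) , tail-twice , init-twice) =
  (i , to O⇔O′ oᵢ , λ j oⱼ → only j (from O⇔O′ oⱼ))
  , (λ x v e → TwiceBy-map {O} {O′} (to O⇔O′) (tail-twice x v e))
  , (λ v y e → TwiceBy-map {O} {O′} (to O⇔O′) (init-twice v y e))

-- Occurrences in split form: equivalent to OccursAt, and the form the combinatorics is done in.
Occ : Word → Word → ℕ → Set
Occ u w p = ∃₂ λ l r → l ++ u ++ r ≡ w × length l ≡ p

Twice : Word → Word → Set
Twice = TwiceBy Occ

MUS : Word → Word → Set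
MUS = MUSBy Occ

take-length-++ : ∀ (u r : Word) → take (length u) (u ++ r) ≡ u
take-length-++ [] r = refl
take-length-++ (x ∷ u) r = cong (x ∷_) (take-length-++ u r)

drop-length-++ : ∀ (l s : Word) → drop (length l) (l ++ s) ≡ s
drop-length-++ [] s = refl
drop-length-++ (x ∷ l) s = drop-length-++ l s

OccursAt⇔Occ : ∀ {u w p} → OccursAt u w p ⇔ Occ u w p
OccursAt⇔Occ {u} {w} {p} = mk⇔ split unsplit
  where
  open ≡-Reasoning
  split : OccursAt u w p → Occ u w p
  split (fits , factor) = take p w , drop (length u) (drop p w) , reassemble
    , trans (length-take p w) (m≤n⇒m⊓n≡m (≤-trans (m≤m+n p (length u)) fits))
    where
    reassemble : take p w ++ u ++ drop (length u) (drop p w) ≡ w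
    reassemble = begin
      take p w ++ u ++ drop (length u) (drop p w)
        ≡⟨ cong (λ v → take p w ++ v ++ drop (length u) (drop p w)) factor ⟨
      take p w ++ take (length u) (drop p w) ++ drop (length u) (drop p w)
        ≡⟨ cong (take p w ++_) (take++drop≡id (length u) (drop p w)) ⟩
      take p w ++ drop p w
        ≡⟨ take++drop≡id p w ⟩
      w ∎
  unsplit : Occ u w p → OccursAt u w p
  unsplit (l , r , refl , refl) = fits , factor
    where
    fits : length l + length u ≤ length (l ++ u ++ r)
    fits rewrite length-++ l {u ++ r} | length-++ u {r} = +-monoʳ-≤ (length l) (m≤m+n (length u) (length r))
    factor : take (length u) (drop (length l) (l ++ u ++ r)) ≡ u
    factor rewrite drop-length-++ l (u ++ r) = take-length-++ u r

IsMUS⇔MUS : ∀ {u w} → IsMUS u w ⇔ MUS u w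
IsMUS⇔MUS =
  mk⇔ (MUSBy-map {OccursAt} {Occ} OccursAt⇔Occ) (MUSBy-map {Occ} {OccursAt} (⇔-sym OccursAt⇔Occ))

Occ-++⁻ : ∀ {u s w p} → Occ (u ++ s) w p → Occ u w p
Occ-++⁻ {u} {s} (l , r , refl , refl) = l , s ++ r , cong (l ++_) (sym (++-assoc u s r)) , refl

Occ-∷⁻ : ∀ {x u w p} → Occ (x ∷ u) w p → Occ u w (suc p)
Occ-∷⁻ {x} {u} (l , r , refl , refl) = l ++ [ x ] , r , ++-assoc l [ x ] (u ++ r) , length-∷ʳ l x

determined⇒¬Twice : ∀ {v w n} → (∀ q → Occ v w q → q ≡ n) → ¬ Twice v w
determined⇒¬Twice det (i , j , i≢j , oᵢ , oⱼ) = i≢j (trans (det i oᵢ) (sym (det j oⱼ)))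

MUS-∷-∷ʳ : ∀ {x v y w} →
  MUS (x ∷ v ++ [ y ]) w ⇔ (UniqueBy Occ (x ∷ v ++ [ y ]) w × Twice (v ++ [ y ]) w × Twice (x ∷ v) w)
MUS-∷-∷ʳ {x} {v} {y} {w} = mk⇔
  (λ (unique , tail-twice , init-twice) → unique , tail-twice x _ refl , init-twice (x ∷ v) y refl)
  (λ (unique , tail-twice , init-twice) → unique
    , (λ _ _ e → subst (λ v′ → Twice v′ w) (proj₂ (∷-injective e)) tail-twice)
    , (λ _ _ e → subst (λ v′ → Twice v′ w) (∷ʳ-injectiveˡ (x ∷ v) _ e) init-twice))

Occ-μ′ : ∀ {v w k} → Occ v w k → Occ (μ′ v) (μ′ w) (2 * k)
Occ-μ′ {v} (l , r , refl , refl) =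
  μ′ l , μ′ r , trans (cong (μ′ l ++_) (sym (μ′-++ v r))) (sym (μ′-++ l (v ++ r))) , length-μ′ l

Occ-μ′-∷ʳ : ∀ {v d w k} → Occ (v ++ [ d ]) w k → Occ (μ′ v ++ [ d ]) (μ′ w) (2 * k)
Occ-μ′-∷ʳ {v} {d} o = Occ-++⁻ {s = [ flipL d ]} (subst (λ u → Occ u _ _) image (Occ-μ′ o))
  where
  image : μ′ (v ++ [ d ]) ≡ (μ′ v ++ [ d ]) ++ [ flipL d ]
  image = trans (μ′-++ v [ d ]) (sym (++-assoc (μ′ v) [ d ] [ flipL d ]))

Occ-∷-μ′ : ∀ {c v w k} → Occ (c ∷ v) w k → Occ (flipL c ∷ μ′ v) (μ′ w) (suc (2 * k))
Occ-∷-μ′ o = Occ-∷⁻ (Occ-μ′ o)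

Occ-∷-μ′-∷ʳ : ∀ {c v d w k} → Occ (c ∷ v ++ [ d ]) w k →
  Occ (flipL c ∷ μ′ v ++ [ d ]) (μ′ w) (suc (2 * k))
Occ-∷-μ′-∷ʳ {v = v} o = Occ-∷⁻ (Occ-μ′-∷ʳ {v = _ ∷ v} o)

Twice-map : ∀ {v w v′ w′} (f : ℕ → ℕ) → (∀ {m n} → f m ≡ f n → m ≡ n) →
  (∀ {k} → Occ v w k → Occ v′ w′ (f k)) → Twice v w → Twice v′ w′
Twice-map f f-injective push (i , j , i≢j , oᵢ , oⱼ) = f i , f j , i≢j ∘ f-injective , push oᵢ , push oⱼ

Twice-unmap : ∀ {v w v′ w′} (f : ℕ → ℕ) → (∀ {q} → Occ v′ w′ q → ∃ λ k → q ≡ f k × Occ v w k) →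
  Twice v′ w′ → Twice v w
Twice-unmap f pull (i , j , i≢j , oᵢ , oⱼ) with pull oᵢ | pull oⱼ
... | k , refl , o | k′ , refl , o′ = k , k′ , i≢j ∘ cong f , o , o′

Twice-μ′ : ∀ {v w} → Twice v w → Twice (μ′ v) (μ′ w)
Twice-μ′ = Twice-map (2 *_) 2*-injective Occ-μ′

Twice-μ′-∷ʳ : ∀ {v d w} → Twice (v ++ [ d ]) w → Twice (μ′ v ++ [ d ]) (μ′ w)
Twice-μ′-∷ʳ {v} = Twice-map (2 *_) 2*-injective (Occ-μ′-∷ʳ {v = v})

Twice-∷-μ′ : ∀ {c v w} → Twice (c ∷ v) w → Twice (flipL c ∷ μ′ v) (μ′ w)
Twice-∷-μ′ = Twice-map (suc ∘ (2 *_)) (2*-injective ∘ suc-injective) Occ-∷-μ′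

Twice-∷-μ′-∷ʳ : ∀ {c v d w} → Twice (c ∷ v ++ [ d ]) w → Twice (flipL c ∷ μ′ v ++ [ d ]) (μ′ w)
Twice-∷-μ′-∷ʳ {v = v} =
  Twice-map (suc ∘ (2 *_)) (2*-injective ∘ suc-injective) (Occ-∷-μ′-∷ʳ {v = v})

data Cut (w l s : Word) : Set where
  even : ∀ w₁ w₂ → w ≡ w₁ ++ w₂ → l ≡ μ′ w₁ → s ≡ μ′ w₂ → Cut w l s
  odd : ∀ w₁ c w₂ → w ≡ w₁ ++ c ∷ w₂ → l ≡ μ′ w₁ ++ [ c ] → s ≡ flipL c ∷ μ′ w₂ → Cut w l s

cut : ∀ w l s → l ++ s ≡ μ′ w → Cut w l s
cut w [] s e = even [] w refl refl e
cut (c ∷ w) (x ∷ []) s refl = odd [] c w refl refl refl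
cut (c ∷ w) (x ∷ y ∷ l) s e with ∷-injective e
... | refl , e′ with ∷-injective e′
... | refl , e″ with cut w l s e″
... | even w₁ w₂ refl refl refl = even (c ∷ w₁) w₂ refl refl refl
... | odd w₁ d w₂ refl refl refl = odd (c ∷ w₁) d w₂ refl refl refl

-- The constructor names give the parities of the start and the end position of the occurrence.
data Desubst (u w : Word) (p : ℕ) : Set where
  empty : ∀ k → u ≡ [] → p ≡ suc (2 * k) → Occ [] w k → Desubst u w p
  ee : ∀ v k → u ≡ μ′ v → p ≡ 2 * k → Occ v w k → Desubst u w p
  eo : ∀ v d k → u ≡ μ′ v ++ [ d ] → p ≡ 2 * k → Occ (v ++ [ d ]) w k → Desubst u w p
  oe : ∀ c v k → u ≡ flipL c ∷ μ′ v → p ≡ suc (2 * k) → Occ (c ∷ v) w k → Desubst u w p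
  oo : ∀ c v d k → u ≡ flipL c ∷ μ′ v ++ [ d ] → p ≡ suc (2 * k) → Occ (c ∷ v ++ [ d ]) w k →
    Desubst u w p

desubst : ∀ {u w p} → Occ u (μ′ w) p → Desubst u w p
desubst {u} {w} (l , r , e , refl) with cut w l (u ++ r) e
... | even w₁ w₂ refl refl e₂ with cut w₂ u r e₂
...   | even v r′ refl refl refl =
  ee v (length w₁) refl (length-μ′ w₁) (w₁ , r′ , refl , refl)
...   | odd v d r′ refl refl refl =
  eo v d (length w₁) refl (length-μ′ w₁) (w₁ , r′ , cong (w₁ ++_) (++-assoc v [ d ] r′) , refl)
desubst {[]} (l , r , e , refl) | odd w₁ c w₂ refl refl e₂ =
  empty (length w₁) refl (length-μ′-∷ʳ w₁ c) (w₁ , c ∷ w₂ , refl , refl)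
desubst {x ∷ u} (l , r , e , refl) | odd w₁ c w₂ refl refl e₂ with ∷-injective e₂
... | refl , e₃ with cut w₂ u r e₃
...   | even v r′ refl refl refl =
  oe c v (length w₁) refl (length-μ′-∷ʳ w₁ c) (w₁ , r′ , refl , refl)
...   | odd v d r′ refl refl refl =
  oo c v d (length w₁) refl (length-μ′-∷ʳ w₁ c)
    (w₁ , r′ , cong (λ z → w₁ ++ c ∷ z) (++-assoc v [ d ] r′) , refl)

NoTripleLetter : Word → Set
NoTripleLetter w = ∀ x p → ¬ Occ (x ∷ x ∷ x ∷ []) w p

μ′-noTripleLetter : ∀ w → NoTripleLetter (μ′ w)
μ′-noTripleLetter w x p o with desubst o
... | ee (a ∷ _) _ () _ _
... | ee (b ∷ _) _ () _ _
... | eo (a ∷ _) _ _ () _ _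
... | eo (b ∷ _) _ _ () _ _
... | oe _ (a ∷ _) _ () _ _
... | oe _ (b ∷ _) _ () _ _
... | oo _ (a ∷ _) _ _ () _ _
... | oo _ (b ∷ _) _ _ () _ _

-- At an odd position, c c̄ d d̄ could only come from an occurrence of x x x in w.
Occ-μ′-sync : ∀ {w c d r q} → NoTripleLetter w → Occ (c ∷ flipL c ∷ d ∷ flipL d ∷ r) (μ′ w) q →
  ∃ λ k → q ≡ 2 * k
Occ-μ′-sync nt o with desubst o
... | ee _ k _ q≡ _ = k , q≡
... | eo _ _ k _ q≡ _ = k , q≡
... | oe a (_ ∷ _ ∷ _) _ refl _ o′ = ⊥-elim (nt a _ (Occ-++⁻ o′))
... | oe b (_ ∷ _ ∷ _) _ refl _ o′ = ⊥-elim (nt b _ (Occ-++⁻ o′))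
... | oo a (_ ∷ []) _ _ refl _ o′ = ⊥-elim (nt a _ o′)
... | oo b (_ ∷ []) _ _ refl _ o′ = ⊥-elim (nt b _ o′)
... | oo a (_ ∷ _ ∷ _) _ _ refl _ o′ = ⊥-elim (nt a _ (Occ-++⁻ o′))
... | oo b (_ ∷ _ ∷ _) _ _ refl _ o′ = ⊥-elim (nt b _ (Occ-++⁻ o′))

Occ-∷-μ′⁻ : ∀ {w c g h v q} → NoTripleLetter w → Occ (flipL c ∷ μ′ (g ∷ h ∷ v)) (μ′ w) q →
  ∃ λ k → q ≡ suc (2 * k) × Occ (c ∷ g ∷ h ∷ v) w k
Occ-∷-μ′⁻ {w} {c} {g} {h} {v} nt o with Occ-μ′-sync nt (Occ-∷⁻ o) | desubst o
... | m , q+1≡ | ee _ k _ refl _ = contradiction q+1≡ (even≢odd m k ∘ sym)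
... | m , q+1≡ | eo _ _ k _ refl _ = contradiction q+1≡ (even≢odd m k ∘ sym)
... | _ | oo _ v′ d _ eq _ _ = ⊥-elim (μ′-∷ʳ-≢ v′ d (g ∷ h ∷ v) (sym (proj₂ (∷-injective eq))))
... | _ | oe c′ v′ k eq refl o′ with ∷-injective eq
...   | c≡ , image≡ =
  k , refl , subst₂ (λ x y → Occ (x ∷ y) w k) (flipL-injective (sym c≡)) (μ′-injective _ _ (sym image≡)) o′

Occ-∷-μ′-∷ʳ⁻ : ∀ {w c g h v t q} → NoTripleLetter w →
  Occ (flipL c ∷ μ′ (g ∷ h ∷ v) ++ [ t ]) (μ′ w) q →
  ∃ λ k → q ≡ suc (2 * k) × Occ (c ∷ (g ∷ h ∷ v) ++ [ t ]) w k
Occ-∷-μ′-∷ʳ⁻ {w} {c} {g} {h} {v} {t} nt o with Occ-μ′-sync nt (Occ-∷⁻ o) | desubst o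
... | m , q+1≡ | ee _ k _ refl _ = contradiction q+1≡ (even≢odd m k ∘ sym)
... | m , q+1≡ | eo _ _ k _ refl _ = contradiction q+1≡ (even≢odd m k ∘ sym)
... | _ | oe _ v′ _ eq _ _ = ⊥-elim (μ′-∷ʳ-≢ (g ∷ h ∷ v) t v′ (proj₂ (∷-injective eq)))
... | _ | oo c′ v′ d k eq refl o′ with ∷-injective eq
...   | c≡ , e with ∷ʳ-injective (μ′ (g ∷ h ∷ v)) (μ′ v′) e
...     | image≡ , refl =
  k , refl
    , subst₂ (λ x y → Occ (x ∷ y ++ [ t ]) w k) (flipL-injective (sym c≡)) (μ′-injective _ _ (sym image≡)) o′

Occ-μ′-∷ʳ⁻ : ∀ {w g h v t q} → NoTripleLetter w → Occ (μ′ (g ∷ h ∷ v) ++ [ t ]) (μ′ w) q →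
  ∃ λ k → q ≡ 2 * k × Occ ((g ∷ h ∷ v) ++ [ t ]) w k
Occ-μ′-∷ʳ⁻ {w} {g} {h} {v} {t} nt o with Occ-μ′-sync nt o | desubst o
... | m , q≡ | oe _ _ k _ refl _ = contradiction q≡ (even≢odd m k ∘ sym)
... | m , q≡ | oo _ _ _ k _ refl _ = contradiction q≡ (even≢odd m k ∘ sym)
... | _ | ee v′ _ eq _ _ = ⊥-elim (μ′-∷ʳ-≢ (g ∷ h ∷ v) t v′ eq)
... | _ | eo v′ d k eq refl o′ with ∷ʳ-injective (μ′ (g ∷ h ∷ v)) (μ′ v′) eq
...   | image≡ , refl =
  k , refl , subst (λ y → Occ (y ++ [ t ]) w k) (μ′-injective _ _ (sym image≡)) o′

RepeatedUpTo : ℕ → Word → Set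
RepeatedUpTo n w = ∀ {u p} → length u ≤ n → Occ u w p → Twice u w

RepeatedUpTo-μ′ : ∀ {w} m → RepeatedUpTo (suc m) w → RepeatedUpTo (suc (2 * m)) (μ′ w)
RepeatedUpTo-μ′ m rep short o with desubst o
... | empty _ refl _ o′ = Twice-μ′ (rep z≤n o′)
... | ee v _ refl _ o′ =
  Twice-μ′ (rep (m≤n⇒m≤1+n (2*m≤1+2*n⇒m≤n (subst (_≤ _) (length-μ′ v) short))) o′)
... | eo v d _ refl _ o′ = Twice-μ′-∷ʳ {v = v} (rep bound o′)
  where
  bound : length (v ++ [ d ]) ≤ suc m
  bound rewrite length-∷ʳ v d = s≤s (*-cancelˡ-≤ 2 (≤-pred (subst (_≤ _) (length-μ′-∷ʳ v d) short)))
... | oe c v _ refl _ o′ =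
  Twice-∷-μ′ (rep (s≤s (*-cancelˡ-≤ 2 (subst (_≤ _) (length-μ′ v) (≤-pred short)))) o′)
... | oo c v d _ refl _ o′ = Twice-∷-μ′-∷ʳ {v = v} (rep bound o′)
  where
  bound : length (c ∷ v ++ [ d ]) ≤ suc m
  bound rewrite length-∷ʳ v d = s≤s (*-cancelˡ-< 2 _ _ (subst (_≤ _) (length-μ′-∷ʳ v d) (≤-pred short)))

-- In the non-oo shapes, a proper factor of u that a MUS requires to occur twice (its tail or its
-- init) has every occurrence extending to an occurrence of u, so it occurs only once.
MUS-μ′-shape : ∀ {w u} → NoTripleLetter w → MUS u (μ′ w) → 6 ≤ length u →
  ∃ λ c → ∃₂ λ v d → 2 ≤ length v × u ≡ flipL c ∷ μ′ v ++ [ d ]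
MUS-μ′-shape {w} nt ((p , o , only) , tail-twice , init-twice) long with desubst o | long
... | oo c (g ∷ h ∷ v) d _ refl _ _ | _ = c , g ∷ h ∷ v , d , s≤s (s≤s z≤n) , refl
... | ee (c ∷ g ∷ h ∷ v) _ refl _ _ | _ =
  ⊥-elim (determined⇒¬Twice tail-determined (tail-twice c _ refl))
  where
  tail-determined : ∀ q → Occ (flipL c ∷ μ′ (g ∷ h ∷ v)) (μ′ w) q → q ≡ suc p
  tail-determined q o′ with Occ-∷-μ′⁻ nt o′
  ... | k , refl , o″ = cong suc (only _ (Occ-μ′ o″))
... | eo (c ∷ g ∷ h ∷ v) d _ refl _ _ | _ =
  ⊥-elim (determined⇒¬Twice tail-determined (tail-twice c _ refl))
  where
  tail-determined : ∀ q → Occ (flipL c ∷ μ′ (g ∷ h ∷ v) ++ [ d ]) (μ′ w) q → q ≡ suc p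
  tail-determined q o′ with Occ-∷-μ′-∷ʳ⁻ nt o′
  ... | k , refl , o″ = cong suc (only _ (Occ-μ′-∷ʳ {v = c ∷ g ∷ h ∷ v} o″))
... | empty _ refl _ _ | ()
... | ee (_ ∷ []) _ refl _ _ | s≤s (s≤s ())
... | ee (_ ∷ _ ∷ []) _ refl _ _ | s≤s (s≤s (s≤s (s≤s ())))
... | eo [] _ _ refl _ _ | s≤s ()
... | eo (_ ∷ []) _ _ refl _ _ | s≤s (s≤s (s≤s ()))
... | eo (_ ∷ _ ∷ []) _ _ refl _ _ | s≤s (s≤s (s≤s (s≤s (s≤s ()))))
... | oo _ [] _ _ refl _ _ | s≤s (s≤s ())
... | oo _ (_ ∷ []) _ _ refl _ _ | s≤s (s≤s (s≤s (s≤s ())))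
... | oe c v _ refl _ _ | long′ with initLast v | long′
...   | (g ∷ h ∷ s) ∷ʳ′ t | _ =
  ⊥-elim (determined⇒¬Twice init-determined (init-twice _ (flipL t) split))
  where
  split : flipL c ∷ μ′ ((g ∷ h ∷ s) ++ [ t ]) ≡ (flipL c ∷ μ′ (g ∷ h ∷ s) ++ [ t ]) ++ [ flipL t ]
  split = cong (flipL c ∷_)
    (trans (μ′-++ (g ∷ h ∷ s) [ t ]) (sym (++-assoc (μ′ (g ∷ h ∷ s)) [ t ] [ flipL t ])))
  init-determined : ∀ q → Occ (flipL c ∷ μ′ (g ∷ h ∷ s) ++ [ t ]) (μ′ w) q → q ≡ p
  init-determined q o′ with Occ-∷-μ′-∷ʳ⁻ nt o′
  ... | k , refl , o″ = only _ (Occ-∷-μ′ o″)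
...   | [] | s≤s ()
...   | [] ∷ʳ′ _ | s≤s (s≤s (s≤s ()))
...   | (_ ∷ []) ∷ʳ′ _ | s≤s (s≤s (s≤s (s≤s (s≤s ()))))

MUS-μ′⁺ : ∀ {w c v d} → NoTripleLetter w → 2 ≤ length v →
  MUS (c ∷ v ++ [ d ]) w → MUS (flipL c ∷ μ′ v ++ [ d ]) (μ′ w)
MUS-μ′⁺ {v = _ ∷ []} _ (s≤s ()) _
MUS-μ′⁺ {w} {c} {g ∷ h ∷ v} {d} nt _ mus with to MUS-∷-∷ʳ mus
... | (k , o , only) , tail-twice , init-twice =
  from (MUS-∷-∷ʳ {x = flipL c} {v = μ′ (g ∷ h ∷ v)})
    ( (suc (2 * k) , Occ-∷-μ′-∷ʳ {v = g ∷ h ∷ v} o , only′)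
    , Twice-μ′-∷ʳ {v = g ∷ h ∷ v} tail-twice
    , Twice-∷-μ′ init-twice)
  where
  only′ : ∀ q → Occ (flipL c ∷ μ′ (g ∷ h ∷ v) ++ [ d ]) (μ′ w) q → q ≡ suc (2 * k)
  only′ q o′ with Occ-∷-μ′-∷ʳ⁻ nt o′
  ... | k′ , refl , o″ = cong (suc ∘ (2 *_)) (only k′ o″)

MUS-μ′⁻ : ∀ {w c v d} → NoTripleLetter w → 2 ≤ length v →
  MUS (flipL c ∷ μ′ v ++ [ d ]) (μ′ w) → MUS (c ∷ v ++ [ d ]) w
MUS-μ′⁻ {v = _ ∷ []} _ (s≤s ()) _
MUS-μ′⁻ {w} {c} {g ∷ h ∷ v} {d} nt _ mus with to (MUS-∷-∷ʳ {x = flipL c} {v = μ′ (g ∷ h ∷ v)}) mus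
... | (p , o , only) , tail-twice , init-twice with Occ-∷-μ′-∷ʳ⁻ nt o
...   | k , refl , o′ =
  from MUS-∷-∷ʳ
    ( (k , o′ , only′)
    , Twice-unmap (2 *_) (Occ-μ′-∷ʳ⁻ nt) tail-twice
    , Twice-unmap (suc ∘ (2 *_)) (Occ-∷-μ′⁻ nt) init-twice)
  where
  only′ : ∀ k′ → Occ (c ∷ (g ∷ h ∷ v) ++ [ d ]) w k′ → k′ ≡ k
  only′ k′ o″ = 2*-injective (suc-injective (only _ (Occ-∷-μ′-∷ʳ {v = g ∷ h ∷ v} o″)))

InExtOrComp : Word → Word → Set
InExtOrComp B u = InExt B u ⊎ InExt (comp B) u

InExt-μ′ : ∀ {B c v d} → InExt B (c ∷ v ++ [ d ]) → InExt (μ′ B) (flipL c ∷ μ′ v ++ [ d ])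
InExt-μ′ {B} {c} {v} {d} (_ , _ , e) =
  flipL c , d , cong (λ v′ → flipL c ∷ μ′ v′ ++ [ d ]) (∷ʳ-injectiveˡ v B (proj₂ (∷-injective e)))

InExtOrComp-μ′ : ∀ {B c v d} → InExtOrComp B (c ∷ v ++ [ d ]) →
  InExtOrComp (μ′ B) (flipL c ∷ μ′ v ++ [ d ])
InExtOrComp-μ′ {B} = ⊎-map InExt-μ′ (subst (λ B′ → InExt B′ _) (μ′-comp B) ∘ InExt-μ′)

MUS-μ′ : ∀ {w B} → NoTripleLetter w → RepeatedUpTo 5 (μ′ w) → 2 ≤ length B →
  (∀ u → MUS u w ⇔ InExtOrComp B u) → ∀ u → MUS u (μ′ w) ⇔ InExtOrComp (μ′ B) u
MUS-μ′ {w} {B} nt rep 2≤B mus⇔ u = mk⇔ MUS⇒ext ext⇒MUS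
  where
  ext-MUS : ∀ B′ → 2 ≤ length B′ → (∀ x y → MUS (x ∷ B′ ++ [ y ]) w) →
    ∀ x y → MUS (x ∷ μ′ B′ ++ [ y ]) (μ′ w)
  ext-MUS B′ 2≤B′ mus x y =
    subst (λ x′ → MUS (x′ ∷ μ′ B′ ++ [ y ]) (μ′ w)) (flipL-involutive x) (MUS-μ′⁺ nt 2≤B′ (mus (flipL x) y))
  MUS⇒ext : MUS u (μ′ w) → InExtOrComp (μ′ B) u
  MUS⇒ext mus@((_ , o , only) , _) with length u ≤? 5
  ... | yes short = contradiction (rep short o) (determined⇒¬Twice only)
  ... | no long with MUS-μ′-shape nt mus (≰⇒> long)
  ...   | c , v , d , 2≤v , refl = InExtOrComp-μ′ (to (mus⇔ _) (MUS-μ′⁻ nt 2≤v mus))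
  ext⇒MUS : InExtOrComp (μ′ B) u → MUS u (μ′ w)
  ext⇒MUS (inj₁ (x , y , refl)) = ext-MUS B 2≤B (λ x y → from (mus⇔ _) (inj₁ (x , y , refl))) x y
  ext⇒MUS (inj₂ (x , y , refl)) = subst (λ B′ → MUS (x ∷ B′ ++ [ y ]) (μ′ w)) (μ′-comp B)
    (ext-MUS (comp B) (subst (2 ≤_) (sym (length-comp B)) 2≤B)
      (λ x y → from (mus⇔ _) (inj₂ (x , y , refl))) x y)

_≟L_ : DecidableEquality Letter
a ≟L a = yes refl
a ≟L b = no λ ()
b ≟L a = no λ ()
b ≟L b = yes refl

_≟W_ : DecidableEquality Word
_≟W_ = ≡-dec _≟L_

∃Letter? : {P : Letter → Set} → (∀ x → Dec (P x)) → Dec (Σ Letter P)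
∃Letter? P? =
  map′ (λ { (inj₁ p) → a , p ; (inj₂ p) → b , p }) (λ { (a , p) → inj₁ p ; (b , p) → inj₂ p }) (P? a ⊎-dec P? b)

∀Letter? : {P : Letter → Set} → (∀ x → Dec (P x)) → Dec (∀ x → P x)
∀Letter? P? = map′ (λ { (pa , pb) a → pa ; (pa , pb) b → pb }) (λ p → p a , p b) (P? a ×-dec P? b)

module _ {P : ℕ → Set} where

  unique? : (xs : List ℕ) → Unique xs → (∀ {i} → i ∈ xs ⇔ P i) →
    Dec (Σ ℕ λ i → P i × (∀ j → P j → j ≡ i))
  unique? [] _ mem = no λ (i , pᵢ , _) → ¬Any[] (from mem pᵢ)
  unique? (i ∷ []) _ mem = yes (i , to mem (here refl) , λ j pⱼ → singleton⁻ (from mem pⱼ))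
  unique? (i ∷ j ∷ _) ((i≢j ∷ _) ∷ _) mem =
    no λ (_ , _ , only) → i≢j (trans (only i (to mem (here refl))) (sym (only j (to mem (there (here refl))))))

  twice? : (xs : List ℕ) → Unique xs → (∀ {i} → i ∈ xs ⇔ P i) →
    Dec (Σ ℕ λ i → Σ ℕ λ j → i ≢ j × P i × P j)
  twice? [] _ mem = no λ (i , _ , _ , pᵢ , _) → ¬Any[] (from mem pᵢ)
  twice? (i ∷ []) _ mem =
    no λ (j , k , j≢k , pⱼ , pₖ) → j≢k (trans (singleton⁻ (from mem pⱼ)) (sym (singleton⁻ (from mem pₖ))))
  twice? (i ∷ j ∷ _) ((i≢j ∷ _) ∷ _) mem = yes (i , j , i≢j , to mem (here refl) , to mem (there (here refl)))

OccursAt? : ∀ u w i → Dec (OccursAt u w i)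
OccursAt? u w i = (i + length u ≤? length w) ×-dec (take (length u) (drop i w) ≟W u)

occurrences : Word → Word → List ℕ
occurrences u w = filter (OccursAt? u w) (upTo (suc (length w)))

∈-occurrences : ∀ {u w i} → i ∈ occurrences u w ⇔ OccursAt u w i
∈-occurrences {u} {w} {i} = mk⇔ (proj₂ ∘ ∈-filter⁻ (OccursAt? u w) {xs = upTo (suc (length w))})
  (λ o → ∈-filter⁺ (OccursAt? u w) (∈-upTo⁺ (s≤s (≤-trans (m≤m+n i (length u)) (proj₁ o)))) o)

occurrences-unique : ∀ u w → Unique (occurrences u w)
occurrences-unique u w = Unique.filter⁺ (OccursAt? u w) (Unique.upTo⁺ (suc (length w)))

OccursTwice? : ∀ v w → Dec (OccursTwice v w)
OccursTwice? v w = twice? (occurrences v w) (occurrences-unique v w) ∈-occurrences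

∀-∷? : {Q : Word → Set} → (∀ v → Dec (Q v)) → ∀ u → Dec (∀ x v → u ≡ x ∷ v → Q v)
∀-∷? Q? [] = yes λ _ _ ()
∀-∷? Q? (x ∷ v) = map′ (λ { q _ _ refl → q }) (λ q → q x v refl) (Q? v)

∀-∷ʳ? : {Q : Word → Set} → (∀ v → Dec (Q v)) → ∀ u → Dec (∀ v y → u ≡ v ++ [ y ] → Q v)
∀-∷ʳ? Q? u with initLast u
... | [] = yes λ { [] _ () ; (_ ∷ _) _ () }
... | v ∷ʳ′ y = map′ (λ q v′ y′ e → subst _ (∷ʳ-injectiveˡ v v′ e) q) (λ q → q v y refl) (Q? v)

IsMUS? : ∀ u w → Dec (IsMUS u w)
IsMUS? u w = unique? (occurrences u w) (occurrences-unique u w) ∈-occurrences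
  ×-dec ∀-∷? (λ v → OccursTwice? v w) u
  ×-dec ∀-∷ʳ? (λ v → OccursTwice? v w) u

InExt? : ∀ B u → Dec (InExt B u)
InExt? B u = ∃Letter? λ x → ∃Letter? λ y → u ≟W (x ∷ B ++ [ y ])

InExtOrComp? : ∀ B u → Dec (InExtOrComp B u)
InExtOrComp? B u = InExt? B u ⊎-dec InExt? (comp B) u

factors-check : ∀ {P : Word → Set} w →
  (∀ {i} → i < suc (length w) → ∀ {m} → m < suc (length w) → P (take m (drop i w))) →
  ∀ {u i} → OccursAt u w i → P u
factors-check {P} w check {u} {i} (fits , factor) =
  subst P factor (check (s≤s (≤-trans (m≤m+n i _) fits)) (s≤s (≤-trans (m≤n+m _ i) fits)))

T₅-MUS⇒ext : ∀ u → IsMUS u (T 5) → InExtOrComp (T 2) u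
T₅-MUS⇒ext u mus@((_ , o , _) , _) =
  factors-check {λ v → IsMUS v (T 5) → InExtOrComp (T 2) v} (T 5)
    (from-yes (allUpTo? (λ i → allUpTo? (λ m →
      let v = take m (drop i (T 5)) in IsMUS? v (T 5) →-dec InExtOrComp? (T 2) v) 17) 17))
    o mus

T₅-ext-MUS : ∀ x y → IsMUS (x ∷ T 2 ++ [ y ]) (T 5) × IsMUS (x ∷ comp (T 2) ++ [ y ]) (T 5)
T₅-ext-MUS = from-yes (∀Letter? λ x → ∀Letter? λ y →
  IsMUS? (x ∷ T 2 ++ [ y ]) (T 5) ×-dec IsMUS? (x ∷ comp (T 2) ++ [ y ]) (T 5))

T₅-ext⇒MUS : ∀ u → InExtOrComp (T 2) u → IsMUS u (T 5)
T₅-ext⇒MUS _ (inj₁ (x , y , refl)) = proj₁ (T₅-ext-MUS x y)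
T₅-ext⇒MUS _ (inj₂ (x , y , refl)) = proj₂ (T₅-ext-MUS x y)

T₅-short-repeated : ∀ {u i} → OccursAt u (T 5) i → length u ≤ 3 → OccursTwice u (T 5)
T₅-short-repeated = factors-check {λ v → length v ≤ 3 → OccursTwice v (T 5)} (T 5)
  (from-yes (allUpTo? (λ i → allUpTo? (λ m →
    let v = take m (drop i (T 5)) in length v ≤? 3 →-dec OccursTwice? v (T 5)) 17) 17))

T-noTripleLetter : ∀ n → NoTripleLetter (T (5 + n))
T-noTripleLetter n = subst NoTripleLetter (sym (T-suc (3 + n))) (μ′-noTripleLetter (T (4 + n)))

T-repeated : ∀ n → RepeatedUpTo 3 (T (5 + n))
T-repeated zero short o =
  TwiceBy-map {OccursAt} {Occ} (to OccursAt⇔Occ) (T₅-short-repeated (from OccursAt⇔Occ o) short)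
T-repeated (suc n) = subst (RepeatedUpTo 3) (sym (T-suc (4 + n)))
  (λ short → RepeatedUpTo-μ′ 2 (T-repeated n) (≤-trans short (m≤n+m 3 2)))

2≤length-T : ∀ n → 2 ≤ length (T (2 + n))
2≤length-T n = subst (2 ≤_) (sym (length-T (suc n))) (*-monoʳ-≤ 2 (m^n>0 2 n))

MUS-T : ∀ n u → MUS u (T (5 + n)) ⇔ InExtOrComp (T (2 + n)) u
MUS-T zero u = mk⇔ (T₅-MUS⇒ext u ∘ from IsMUS⇔MUS) (to IsMUS⇔MUS ∘ T₅-ext⇒MUS u)
MUS-T (suc n) =
  subst₂ (λ w B → ∀ u → MUS u w ⇔ InExtOrComp B u) (sym (T-suc (4 + n))) (sym (T-suc (1 + n)))
  (MUS-μ′ (T-noTripleLetter n) (RepeatedUpTo-μ′ 2 (T-repeated n)) (2≤length-T n) (MUS-T n))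

theorem35 : (i : ℕ) → 5 ≤ i → (u : Word) →
    IsMUS u (T i) ⇔ (InExt (T (i ∸ 3)) u ⊎ InExt (comp (T (i ∸ 3))) u)
theorem35 _ (s≤s (s≤s (s≤s (s≤s (s≤s {n = n} z≤n))))) u = MUS-T n u ⇔-∘ IsMUS⇔MUS
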